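{- For every input of length $n$ composed of $m$ original runs, the merge cost of $2$-merge sort is at most $n\cdot(d_2+c_2\log m)$, where $c_2=3/\log(27/4)\approx 1.08897$ and $d_2=6-c_2\cdot(3\log 3-1)\approx 1.91104$.
   Context: Model: an input is identified with its sequence $\langle n_1,\dots,n_m\rangle$ of positive integer run lengths; $n=\sum_i n_i$ is the input length, $m$ the number of original runs. The algorithm maintains a stack $Q_1,\dots,Q_\ell$ of runs (represented by their lengths), top $Q_\ell$; $X,Y,Z$ denote $Q_{\ell-2},Q_{\ell-1},Q_\ell$ when they exist, and any test involving a nonexistent stack element evaluates to false. "Push" removes the next original run (left to right) and pushes it. "Merge $Y$ and $Z$" replaces the top two runs by one run of length $|Y|+|Z|$; "merge $X$ and $Y$" replaces the second and third runs from the top by one run of length $|X|+|Y|$. A merge of runs $A,B$ costs $|A|+|B|$; the merge cost is the total cost of all merges performed. $\log$ is base 2. $2$-merge sort: while original runs remain: push the next run; then while $|Y|<2|Z|$: if $|X|<|Z|$ merge $X$ and $Y$, else merge $Y$ and $Z$. After all runs are pushed, repeatedly merge $Y$ and $Z$ until one run remains. -}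

module Defs where

open import Data.Nat using (ℕ; zero; suc; _+_; _*_; _<ᵇ_)
open import Data.Bool using (Bool; true; false; if_then_else_)
open import Data.List using (List; []; _∷_; length)
open import Data.Product using (_×_; _,_)

-- The run stack is a list of run lengths with the TOP of the stack at the
-- head:  Z ∷ Y ∷ X ∷ rest   means  Q_ℓ = Z, Q_{ℓ-1} = Y, Q_{ℓ-2} = X.

-- A test involving a nonexistent stack element is false.
-- The fuel argument bounds the number of iterations; each iteration removes
-- one stack entry and needs at least two entries, so fuel = stack length is
-- always sufficient (the loop never stops because fuel ran out).
collapse : ℕ → List ℕ → ℕ × List ℕ
collapse zero s = 0 , s
collapse (suc f) (z ∷ y ∷ []) =
  if y <ᵇ 2 * z
  then (let r = collapse f ((y + z) ∷ []) in
        (let (c , s') = r in (y + z) + c , s'))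
  else (0 , z ∷ y ∷ [])
collapse (suc f) (z ∷ y ∷ x ∷ rest) =
  if y <ᵇ 2 * z
  then (if x <ᵇ z
        then (let (c , s') = collapse f (z ∷ (x + y) ∷ rest) in (x + y) + c , s')
        else (let (c , s') = collapse f ((y + z) ∷ x ∷ rest) in (y + z) + c , s'))
  else (0 , z ∷ y ∷ x ∷ rest)
collapse (suc f) s = 0 , s

pushPhase : List ℕ → List ℕ → ℕ × List ℕ
pushPhase [] s = 0 , s
pushPhase (r ∷ rs) s =
  let (c₁ , s₁) = collapse (length (r ∷ s)) (r ∷ s) in
  let (c₂ , s₂) = pushPhase rs s₁ in
  c₁ + c₂ , s₂

finalFrom : ℕ → List ℕ → ℕ
finalFrom z [] = 0
finalFrom z (y ∷ rest) = (y + z) + finalFrom (y + z) rest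

finalCost : List ℕ → ℕ
finalCost [] = 0
finalCost (z ∷ rest) = finalFrom z rest

mergeCost2 : List ℕ → ℕ
mergeCost2 runs =
  let (c , s) = pushPhase runs [] in c + finalCost s

-- Annotate every run with its length ℓ, the number k of original runs it contains and the cost g
-- spent building it, and write P ≼⟨ e ⟩ Q for (27/4)^e · P ≤ Q.  A run is economical when
-- 1 ≼⟨ g ⟩ k^(3ℓ), that is g ≤ c₂ ℓ log k.  By AM–GM, a^(3y) b^(3t) ≼⟨ y + t ⟩ (a+b)^(3(y+t))
-- whenever y/2 ≤ t ≤ 2y, so merging two economical runs of comparable lengths yields an
-- economical run.  The 2-merge stack invariant makes every merge of the main loop of this kind,
-- except merging Y with a pushed run longer than 2|Y|, which is paid for because (k+1)³ ≥ 8 > 27/4,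
-- and merging X with Y beneath a pending run Z, after which economy is only restored by the merge
-- with Z.  Each merge of the final phase gains at least the shorter length, so the input is sorted
-- at cost ≤ n + c₂ n log m, which implies the theorem because d₂ ≥ 1.

module Submission where

open import Defs
open import Data.Nat using (ℕ; _+_; _*_; _^_; _≤_)
open import Data.List using (List; length)
open import Data.Nat.ListAction using (sum)
open import Data.List.Relation.Unary.All using (All)

open import Data.Nat
open import Data.Nat.Properties
open import Data.Bool using (true; false; if_then_else_)
open import Data.List using ([]; _∷_; map; head)
open import Data.List.Properties using (length-map; map-∘; map-id)
open import Data.Maybe.Relation.Unary.All as Maybe using (just; nothing)
open import Data.Product using (_,_; proj₁; proj₂)
open import Data.Sum using (inj₁; inj₂)
open import Relation.Binary.PropositionalEquality
open import Relation.Nullary.Negation using (contradiction)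
open import Relation.Nullary.Reflects using (ofʸ; ofⁿ)
open import Data.Nat.Tactic.RingSolver using (solve-∀; solve)
open import Algebra.Properties.CommutativeSemigroup *-commutativeSemigroup
  using () renaming (interchange to *-interchange; x∙yz≈y∙xz to x*[y*z]≡y*[x*z]; xy∙z≈y∙xz to x*y*z≡y*[x*z])
open import Algebra.Properties.CommutativeSemigroup +-commutativeSemigroup
  using () renaming (xy∙z≈y∙xz to x+y+z≡y+[x+z]; x∙yz≈y∙xz to x+[y+z]≡y+[x+z])

^-distribʳ-* : ∀ m n o → (m * n) ^ o ≡ m ^ o * n ^ o
^-distribʳ-* m n zero = refl
^-distribʳ-* m n (suc o) = begin
  m * n * (m * n) ^ o       ≡⟨ cong (m * n *_) (^-distribʳ-* m n o) ⟩
  m * n * (m ^ o * n ^ o)   ≡⟨ *-interchange m n (m ^ o) (n ^ o) ⟩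
  m * m ^ o * (n * n ^ o)   ∎
  where open ≡-Reasoning

m+n≤2*o : ∀ {m n o} → m ≤ o → n ≤ o → m + n ≤ 2 * o
m+n≤2*o {o = o} m≤o n≤o = +-mono-≤ m≤o (≤-trans n≤o (m≤m+n o 0))

2m≤n⇒m≤n : ∀ {m n} → 2 * m ≤ n → m ≤ n
2m≤n⇒m≤n {m} 2m≤n = ≤-trans (m≤n*m m 2) 2m≤n

-- (x + 2y)³ − 27xy² = (x − y)² (x + 8y).
27xy²≤[x+2y]³ : ∀ x y → 27 * (x * (y * y)) ≤ (x + y + y) * ((x + y + y) * (x + y + y))
27xy²≤[x+2y]³ x y with ≤-total y x
... | inj₁ y≤x with m≤n⇒∃[o]m+o≡n y≤x
...   | e , refl = begin
  27 * ((y + e) * (y * y))                        ≤⟨ m≤m+n _ (e * e * (9 * y + e)) ⟩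
  27 * ((y + e) * (y * y)) + e * e * (9 * y + e)  ≡⟨ solve (y ∷ e ∷ []) ⟩
  (y + e + y + y) * ((y + e + y + y) * (y + e + y + y)) ∎
  where open ≤-Reasoning
27xy²≤[x+2y]³ x y | inj₂ x≤y with m≤n⇒∃[o]m+o≡n x≤y
...   | e , refl = begin
  27 * (x * ((x + e) * (x + e)))                            ≤⟨ m≤m+n _ (e * e * (9 * x + 8 * e)) ⟩
  27 * (x * ((x + e) * (x + e))) + e * e * (9 * x + 8 * e)  ≡⟨ solve (x ∷ e ∷ []) ⟩
  (x + (x + e) + (x + e)) * ((x + (x + e) + (x + e)) * (x + (x + e) + (x + e))) ∎
  where open ≤-Reasoning

27ab²≤4[a+b]³ : ∀ a b → 27 * (a * (b * b)) ≤ 4 * ((a + b) * ((a + b) * (a + b)))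
27ab²≤4[a+b]³ a b = *-cancelˡ-≤ 2 (begin
  2 * (27 * (a * (b * b)))                              ≡⟨ solve (a ∷ b ∷ []) ⟩
  27 * (2 * a * (b * b))                                ≤⟨ 27xy²≤[x+2y]³ (2 * a) b ⟩
  (2 * a + b + b) * ((2 * a + b + b) * (2 * a + b + b)) ≡⟨ solve (a ∷ b ∷ []) ⟩
  2 * (4 * ((a + b) * ((a + b) * (a + b))))             ∎)
  where open ≤-Reasoning

variable
  e e′ k t y P P′ Q Q′ R : ℕ

infix 4 _≼⟨_⟩_

record _≼⟨_⟩_ (P e Q : ℕ) : Set where
  constructor ≼-intro
  field ≼-elim : 27 ^ e * P ≤ 4 ^ e * Q
open _≼⟨_⟩_ using (≼-elim)

≼-refl : P ≼⟨ 0 ⟩ P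
≼-refl = ≼-intro ≤-refl

≼-mul : P ≼⟨ e ⟩ Q → P′ ≼⟨ e′ ⟩ Q′ → P * P′ ≼⟨ e + e′ ⟩ Q * Q′
≼-mul {P} {e} {Q} {P′} {e′} {Q′} (≼-intro h) (≼-intro h′) = ≼-intro (begin
  27 ^ (e + e′) * (P * P′)    ≡⟨ cong (_* (P * P′)) (^-distribˡ-+-* 27 e e′) ⟩
  27 ^ e * 27 ^ e′ * (P * P′) ≡⟨ *-interchange (27 ^ e) (27 ^ e′) P P′ ⟩
  27 ^ e * P * (27 ^ e′ * P′) ≤⟨ *-mono-≤ h h′ ⟩
  4 ^ e * Q * (4 ^ e′ * Q′)   ≡⟨ *-interchange (4 ^ e) Q (4 ^ e′) Q′ ⟩
  4 ^ e * 4 ^ e′ * (Q * Q′)   ≡⟨ cong (_* (Q * Q′)) (^-distribˡ-+-* 4 e e′) ⟨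
  4 ^ (e + e′) * (Q * Q′)     ∎)
  where open ≤-Reasoning

≼-pow : P ≼⟨ e ⟩ Q → ∀ n → P ^ n ≼⟨ e * n ⟩ Q ^ n
≼-pow {P} {e} {Q} (≼-intro h) n = ≼-intro (begin
  27 ^ (e * n) * P ^ n  ≡⟨ cong (_* P ^ n) (^-*-assoc 27 e n) ⟨
  (27 ^ e) ^ n * P ^ n  ≡⟨ ^-distribʳ-* (27 ^ e) P n ⟨
  (27 ^ e * P) ^ n      ≤⟨ ^-monoˡ-≤ n h ⟩
  (4 ^ e * Q) ^ n       ≡⟨ ^-distribʳ-* (4 ^ e) Q n ⟩
  (4 ^ e) ^ n * Q ^ n   ≡⟨ cong (_* Q ^ n) (^-*-assoc 4 e n) ⟩
  4 ^ (e * n) * Q ^ n   ∎)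
  where open ≤-Reasoning

≼-trans : P ≼⟨ e ⟩ Q → Q ≼⟨ e′ ⟩ R → P ≼⟨ e + e′ ⟩ R
≼-trans {P} {e} {Q} {e′} {R} (≼-intro h) (≼-intro h′) = ≼-intro (begin
  27 ^ (e + e′) * P        ≡⟨ cong (_* P) (^-distribˡ-+-* 27 e e′) ⟩
  27 ^ e * 27 ^ e′ * P     ≡⟨ x*y*z≡y*[x*z] (27 ^ e) (27 ^ e′) P ⟩
  27 ^ e′ * (27 ^ e * P)   ≤⟨ *-monoʳ-≤ (27 ^ e′) h ⟩
  27 ^ e′ * (4 ^ e * Q)    ≡⟨ x*[y*z]≡y*[x*z] (27 ^ e′) (4 ^ e) Q ⟩
  4 ^ e * (27 ^ e′ * Q)    ≤⟨ *-monoʳ-≤ (4 ^ e) h′ ⟩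
  4 ^ e * (4 ^ e′ * R)     ≡⟨ *-assoc (4 ^ e) (4 ^ e′) R ⟨
  4 ^ e * 4 ^ e′ * R       ≡⟨ cong (_* R) (^-distribˡ-+-* 4 e e′) ⟨
  4 ^ (e + e′) * R         ∎)
  where open ≤-Reasoning

≼-subst : e ≡ e′ → P ≡ P′ → Q ≡ Q′ → P ≼⟨ e ⟩ Q → P′ ≼⟨ e′ ⟩ Q′
≼-subst refl refl refl h = h

≼-weaken : e′ ≤ e → P ≼⟨ e ⟩ Q → P ≼⟨ e′ ⟩ Q
≼-weaken {e′} {e} {P} {Q} e′≤e (≼-intro h) with m≤n⇒∃[o]m+o≡n e′≤e
... | d , refl = ≼-intro (*-cancelˡ-≤ (4 ^ d) {{m^n≢0 4 d}} (begin
  4 ^ d * (27 ^ e′ * P)   ≤⟨ *-monoˡ-≤ _ (^-monoˡ-≤ d (≤ᵇ⇒≤ 4 27 _)) ⟩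
  27 ^ d * (27 ^ e′ * P)  ≡⟨ x*[y*z]≡y*[x*z] (27 ^ d) (27 ^ e′) P ⟩
  27 ^ e′ * (27 ^ d * P)  ≡⟨ *-assoc (27 ^ e′) (27 ^ d) P ⟨
  27 ^ e′ * 27 ^ d * P    ≡⟨ cong (_* P) (^-distribˡ-+-* 27 e′ d) ⟨
  27 ^ (e′ + d) * P       ≤⟨ h ⟩
  4 ^ (e′ + d) * Q        ≡⟨ cong (_* Q) (^-distribˡ-+-* 4 e′ d) ⟩
  4 ^ e′ * 4 ^ d * Q      ≡⟨ x*y*z≡y*[x*z] (4 ^ e′) (4 ^ d) Q ⟩
  4 ^ d * (4 ^ e′ * Q)    ∎))
  where open ≤-Reasoning

monomial-pow : ∀ a b p q n → (a ^ p * b ^ q) ^ n ≡ a ^ (p * n) * b ^ (q * n)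
monomial-pow a b p q n = begin
  (a ^ p * b ^ q) ^ n        ≡⟨ ^-distribʳ-* (a ^ p) (b ^ q) n ⟩
  (a ^ p) ^ n * (b ^ q) ^ n  ≡⟨ cong₂ _*_ (^-*-assoc a p n) (^-*-assoc b q n) ⟩
  a ^ (p * n) * b ^ (q * n)  ∎
  where open ≡-Reasoning

monomial-mul : ∀ a b p q r s → a ^ p * b ^ q * (a ^ r * b ^ s) ≡ a ^ (p + r) * b ^ (q + s)
monomial-mul a b p q r s = begin
  a ^ p * b ^ q * (a ^ r * b ^ s)  ≡⟨ *-interchange (a ^ p) (b ^ q) (a ^ r) (b ^ s) ⟩
  a ^ p * a ^ r * (b ^ q * b ^ s)  ≡⟨ cong₂ _*_ (^-distribˡ-+-* a p r) (^-distribˡ-+-* b q s) ⟨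
  a ^ (p + r) * b ^ (q + s)        ∎
  where open ≡-Reasoning

≼-combine : ∀ a b c p q u r s v → a ^ p * b ^ q ≼⟨ e ⟩ c ^ u → a ^ r * b ^ s ≼⟨ e′ ⟩ c ^ v → ∀ m n →
            a ^ (p * m + r * n) * b ^ (q * m + s * n) ≼⟨ e * m + e′ * n ⟩ c ^ (u * m + v * n)
≼-combine a b c p q u r s v h h′ m n =
  ≼-subst refl P≡ Q≡ (≼-mul (≼-pow h m) (≼-pow h′ n))
  where
  P≡ : (a ^ p * b ^ q) ^ m * (a ^ r * b ^ s) ^ n ≡ a ^ (p * m + r * n) * b ^ (q * m + s * n)
  P≡ = trans (cong₂ _*_ (monomial-pow a b p q m) (monomial-pow a b r s n))
             (monomial-mul a b (p * m) (q * m) (r * n) (s * n))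
  Q≡ : (c ^ u) ^ m * (c ^ v) ^ n ≡ c ^ (u * m + v * n)
  Q≡ = trans (cong₂ _*_ (^-*-assoc c u m) (^-*-assoc c v n)) (sym (^-distribˡ-+-* c (u * m) (v * n)))

a¹b²≼₁[a+b]³ : ∀ a b → a ^ 1 * b ^ 2 ≼⟨ 1 ⟩ (a + b) ^ 3
a¹b²≼₁[a+b]³ a b = ≼-intro (subst₂ (λ P Q → 27 * P ≤ 4 * Q) P≡ Q≡ (27ab²≤4[a+b]³ a b))
  where
  P≡ : a * (b * b) ≡ a ^ 1 * b ^ 2
  P≡ = cong₂ _*_ (sym (^-identityʳ a)) (cong (b *_) (sym (^-identityʳ b)))
  Q≡ : (a + b) * ((a + b) * (a + b)) ≡ (a + b) ^ 3
  Q≡ = cong (λ x → (a + b) * ((a + b) * x)) (sym (^-identityʳ (a + b)))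

a²b¹≼₁[a+b]³ : ∀ a b → a ^ 2 * b ^ 1 ≼⟨ 1 ⟩ (a + b) ^ 3
a²b¹≼₁[a+b]³ a b = ≼-subst refl (*-comm (b ^ 1) (a ^ 2)) (cong (_^ 3) (+-comm b a)) (a¹b²≼₁[a+b]³ b a)

a³b³≼₁[a+b]⁶ : ∀ a b → a ^ 3 * b ^ 3 ≼⟨ 1 ⟩ (a + b) ^ 6
a³b³≼₁[a+b]⁶ a b =
  ≼-weaken (≤ᵇ⇒≤ 1 2 _) (≼-combine a b (a + b) 1 2 3 2 1 3 (a¹b²≼₁[a+b]³ a b) (a²b¹≼₁[a+b]³ a b) 1 1)

a³b⁰≼₀[a+b]³ : ∀ a b → a ^ 3 * b ^ 0 ≼⟨ 0 ⟩ (a + b) ^ 3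
a³b⁰≼₀[a+b]³ a b =
  ≼-intro (+-monoˡ-≤ 0 (≤-trans (≤-reflexive (*-identityʳ (a ^ 3))) (^-monoˡ-≤ 3 (m≤m+n a b))))

-- (3y, 3t) = (2t − y)·(1, 2) + (2y − t)·(2, 1), with natural weights exactly when y/2 ≤ t ≤ 2y.
gain-balanced : ∀ a b → y ≤ 2 * t → t ≤ 2 * y → a ^ (3 * y) * b ^ (3 * t) ≼⟨ y + t ⟩ (a + b) ^ (3 * (y + t))
gain-balanced {y} {t} a b y≤2t t≤2y with m≤n⇒∃[o]m+o≡n y≤2t | m≤n⇒∃[o]m+o≡n t≤2y
... | α , y+α≡2t | β , t+β≡2y =
  ≼-subst α+β≡y+t (cong₂ (λ m n → a ^ m * b ^ n) α+2β≡3y 2α+β≡3t) (cong ((a + b) ^_) 3α+3β≡3[y+t])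
    (≼-combine a b (a + b) 1 2 3 2 1 3 (a¹b²≼₁[a+b]³ a b) (a²b¹≼₁[a+b]³ a b) α β)
  where
  open ≡-Reasoning
  α+β≡y+t : 1 * α + 1 * β ≡ y + t
  α+β≡y+t = +-cancelˡ-≡ (y + t) _ _ (begin
    y + t + (1 * α + 1 * β)  ≡⟨ solve (y ∷ t ∷ α ∷ β ∷ []) ⟩
    (y + α) + (t + β)        ≡⟨ cong₂ _+_ y+α≡2t t+β≡2y ⟩
    2 * t + 2 * y            ≡⟨ solve (y ∷ t ∷ []) ⟩
    y + t + (y + t)          ∎)
  α+2β≡3y : 1 * α + 2 * β ≡ 3 * y
  α+2β≡3y = begin
    1 * α + 2 * β            ≡⟨ solve (α ∷ β ∷ []) ⟩
    (1 * α + 1 * β) + β      ≡⟨ cong (_+ β) α+β≡y+t ⟩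
    y + t + β                ≡⟨ +-assoc y t β ⟩
    y + (t + β)              ≡⟨ cong (y +_) t+β≡2y ⟩
    y + 2 * y                ≡⟨ solve (y ∷ []) ⟩
    3 * y                    ∎
  2α+β≡3t : 2 * α + 1 * β ≡ 3 * t
  2α+β≡3t = begin
    2 * α + 1 * β            ≡⟨ solve (α ∷ β ∷ []) ⟩
    α + (1 * α + 1 * β)      ≡⟨ cong (α +_) α+β≡y+t ⟩
    α + (y + t)              ≡⟨ solve (α ∷ y ∷ t ∷ []) ⟩
    (y + α) + t              ≡⟨ cong (_+ t) y+α≡2t ⟩
    2 * t + t                ≡⟨ solve (t ∷ []) ⟩
    3 * t                    ∎
  3α+3β≡3[y+t] : 3 * α + 3 * β ≡ 3 * (y + t)
  3α+3β≡3[y+t] = begin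
    3 * α + 3 * β            ≡⟨ solve (α ∷ β ∷ []) ⟩
    3 * (1 * α + 1 * β)      ≡⟨ cong (3 *_) α+β≡y+t ⟩
    3 * (y + t)              ∎

-- (3y, 3t) = t·(3, 3) + (y − t)·(3, 0).
gain-min : ∀ a b → t ≤ y → a ^ (3 * y) * b ^ (3 * t) ≼⟨ t ⟩ (a + b) ^ (3 * (y + t))
gain-min {t} a b t≤y with m≤n⇒∃[o]m+o≡n t≤y
... | r , refl = ≼-subst e≡ (cong₂ (λ m n → a ^ m * b ^ n) y≡ t≡) (cong ((a + b) ^_) y+t≡)
  (≼-combine a b (a + b) 3 3 6 3 0 3 (a³b³≼₁[a+b]⁶ a b) (a³b⁰≼₀[a+b]³ a b) t r)
  where
  e≡ : 1 * t + 0 * r ≡ t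
  e≡ = solve (t ∷ r ∷ [])
  y≡ : 3 * t + 3 * r ≡ 3 * (t + r)
  y≡ = solve (t ∷ r ∷ [])
  t≡ : 3 * t + 0 * r ≡ 3 * t
  t≡ = solve (t ∷ r ∷ [])
  y+t≡ : 6 * t + 3 * r ≡ 3 * (t + r + t)
  y+t≡ = solve (t ∷ r ∷ [])

≼-stretch : ∀ ℓ d → 2 ≤ k → 1 ≼⟨ e ⟩ k ^ (3 * ℓ) → 1 ≼⟨ e + d ⟩ k ^ (3 * (ℓ + d))
≼-stretch {k} {e} ℓ d 2≤k h =
  ≼-subst (cong (e +_) (*-identityˡ d)) (trans (*-identityˡ (1 ^ d)) (^-zeroˡ d)) K≡ (≼-mul h (≼-pow 1≼₁k³ d))
  where
  1≼₁k³ : 1 ≼⟨ 1 ⟩ k ^ 3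
  1≼₁k³ = ≼-intro (≤-trans (≤ᵇ⇒≤ 27 32 _) (*-monoʳ-≤ 4 (^-monoˡ-≤ 3 2≤k)))
  K≡ : k ^ (3 * ℓ) * (k ^ 3) ^ d ≡ k ^ (3 * (ℓ + d))
  K≡ = begin
    k ^ (3 * ℓ) * (k ^ 3) ^ d    ≡⟨ cong (k ^ (3 * ℓ) *_) (^-*-assoc k 3 d) ⟩
    k ^ (3 * ℓ) * k ^ (3 * d)    ≡⟨ ^-distribˡ-+-* k (3 * ℓ) (3 * d) ⟨
    k ^ (3 * ℓ + 3 * d)          ≡⟨ cong (k ^_) (*-distribˡ-+ 3 ℓ d) ⟨
    k ^ (3 * (ℓ + d))            ∎
    where open ≡-Reasoning

4ⁿ≼ₙ27ⁿ : ∀ n → 4 ^ n ≼⟨ n ⟩ 27 ^ n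
4ⁿ≼ₙ27ⁿ n = ≼-intro (≤-reflexive (*-comm (27 ^ n) (4 ^ n)))

-- Annotated runs

record Run : Set where
  constructor run
  field
    len count cost : ℕ
open Run

infixl 6 _⊕_

_⊕_ : Run → Run → Run
len   (A ⊕ B) = len A + len B
count (A ⊕ B) = count A + count B
cost  (A ⊕ B) = cost A + cost B + (len A + len B)

fresh : ℕ → Run
len   (fresh ℓ) = ℓ
count (fresh ℓ) = 1
cost  (fresh ℓ) = 0

record Economical (R : Run) : Set where
  field
    budget   : 1 ≼⟨ cost R ⟩ count R ^ (3 * len R)
    nonempty : 1 ≤ count R
open Economical

-- cost ≤ ℓ + c₂ ℓ log k; the extra ℓ pays for the unbalanced merges of the final phase.
Economical⁺ : Run → Set
Economical⁺ R = 4 ^ len R ≼⟨ cost R ⟩ 27 ^ len R * count R ^ (3 * len R)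

variable
  A B M Y Z : Run
  x z : ℕ

fresh-economical : ∀ ℓ → Economical (fresh ℓ)
fresh-economical ℓ = record
  { budget   = ≼-intro (≤-reflexive (sym (trans (*-identityˡ (1 ^ (3 * ℓ))) (^-zeroˡ (3 * ℓ)))))
  ; nonempty = ≤-refl
  }

⊕-economical : Economical A → Economical B → len A ≤ 2 * len B → len B ≤ 2 * len A → Economical (A ⊕ B)
⊕-economical {A} {B} eA eB a≤2b b≤2a = record
  { budget   = ≼-trans (≼-mul (budget eA) (budget eB)) (gain-balanced (count A) (count B) a≤2b b≤2a)
  ; nonempty = ≤-trans (nonempty eA) (m≤m+n (count A) (count B))
  }

⊕-fresh-mono : ∀ M → 1 ≤ count M → x ≤ z → Economical (M ⊕ fresh x) → Economical (M ⊕ fresh z)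
⊕-fresh-mono {x} M 1≤k x≤z e with m≤n⇒∃[o]m+o≡n x≤z
... | d , refl = record
  { budget   = ≼-subst (cost≡ (cost M) (len M) x d) refl
                       (cong (λ ℓ → (count M + 1) ^ (3 * ℓ)) (+-assoc (len M) x d))
                       (≼-stretch (len M + x) d (+-monoˡ-≤ 1 1≤k) (budget e))
  ; nonempty = nonempty e
  }
  where
  cost≡ : ∀ g m x d → g + 0 + (m + x) + d ≡ g + 0 + (m + (x + d))
  cost≡ = solve-∀

⊕-fresh-economical : Economical Y → len Y ≤ 2 * z → Economical (Y ⊕ fresh z)
⊕-fresh-economical {Y} {z} eY y≤2z with ≤-total z (2 * len Y)
... | inj₁ z≤2y = ⊕-economical eY (fresh-economical z) y≤2z z≤2y
... | inj₂ 2y≤z = ⊕-fresh-mono Y (nonempty eY) 2y≤z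
                    (⊕-economical eY (fresh-economical (2 * len Y)) (2m≤n⇒m≤n (m≤n*m _ 2)) ≤-refl)

-- The two merge orders cost the same because A and the fresh run have equal lengths.
⊕-fresh-assoc : ∀ A B → A ⊕ (B ⊕ fresh (len A)) ≡ (A ⊕ B) ⊕ fresh (len A)
⊕-fresh-assoc (run a k g) (run b k′ g′) = run-≡ (len≡ a b) (count≡ k k′) (cost≡ g g′ a b)
  where
  len≡ : ∀ a b → a + (b + a) ≡ a + b + a
  len≡ = solve-∀
  count≡ : ∀ k k′ → k + (k′ + 1) ≡ k + k′ + 1
  count≡ = solve-∀
  cost≡ : ∀ g g′ a b → g + (g′ + 0 + (b + a)) + (a + (b + a)) ≡ g + g′ + (a + b) + 0 + (a + b + a)
  cost≡ = solve-∀
  run-≡ : ∀ {ℓ ℓ′ k k′ c c′} → ℓ ≡ ℓ′ → k ≡ k′ → c ≡ c′ → run ℓ k c ≡ run ℓ′ k′ c′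
  run-≡ refl refl refl = refl

economical⇒economical⁺ : Economical A → Economical⁺ A
economical⇒economical⁺ {A} eA =
  ≼-subst refl (*-identityʳ (4 ^ len A)) refl (≼-mul 4ⁿ≼₀27ⁿ (budget eA))
  where
  4ⁿ≼₀27ⁿ : 4 ^ len A ≼⟨ 0 ⟩ 27 ^ len A
  4ⁿ≼₀27ⁿ = ≼-intro (*-monoʳ-≤ 1 (^-monoˡ-≤ (len A) (≤ᵇ⇒≤ 4 27 _)))

⊕-economical⁺ : Economical Y → Economical⁺ Z → len Z ≤ len Y → Economical⁺ (Y ⊕ Z)
⊕-economical⁺ {Y} {Z} eY eZ z≤y =
  ≼-subst (cost≡ (len Y) (cost Y) (cost Z) (len Z)) (sym (^-distribˡ-+-* 4 (len Y) (len Z)))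
          Q≡
    (≼-mul (4ⁿ≼ₙ27ⁿ (len Y))
           (≼-trans budgets (≼-mul (≼-refl {27 ^ len Z}) (gain-min (count Y) (count Z) z≤y))))
  where
  budgets : 4 ^ len Z ≼⟨ cost Y + cost Z ⟩ 27 ^ len Z * (count Y ^ (3 * len Y) * count Z ^ (3 * len Z))
  budgets = ≼-subst refl (*-identityˡ (4 ^ len Z)) (x*[y*z]≡y*[x*z] (count Y ^ (3 * len Y)) (27 ^ len Z) _)
              (≼-mul (budget eY) eZ)
  K = (count Y + count Z) ^ (3 * (len Y + len Z))
  Q≡ : 27 ^ len Y * (27 ^ len Z * K) ≡ 27 ^ (len Y + len Z) * K
  Q≡ = trans (sym (*-assoc (27 ^ len Y) (27 ^ len Z) K))
             (cong (_* K) (sym (^-distribˡ-+-* 27 (len Y) (len Z))))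
  cost≡ : ∀ y g g′ z → y + (g + g′ + z) ≡ g + g′ + (y + z)
  cost≡ = solve-∀

-- 128 ≤ 729, i.e. 2³ ≤ (27/4)², is the inequality d₂ ≥ 1.
economical⁺-bound : ∀ A → Economical⁺ A →
  2 ^ (9 * len A) * 27 ^ cost A ≤ count A ^ (3 * len A) * 4 ^ cost A * 27 ^ (3 * len A)
economical⁺-bound A eA = begin
  2 ^ (9 * n) * 27 ^ cost A        ≡⟨ *-comm (2 ^ (9 * n)) (27 ^ cost A) ⟩
  27 ^ cost A * 2 ^ (9 * n)        ≤⟨ ≼-elim (≼-subst refl P≡ Q≡ (≼-mul 128ⁿ≼₀729ⁿ eA)) ⟩
  4 ^ cost A * (27 ^ (3 * n) * K)  ≡⟨ rearrange (4 ^ cost A) (27 ^ (3 * n)) K ⟩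
  K * 4 ^ cost A * 27 ^ (3 * n)    ∎
  where
  open ≤-Reasoning
  n = len A
  K = count A ^ (3 * n)
  128ⁿ≼₀729ⁿ : 128 ^ n ≼⟨ 0 ⟩ 729 ^ n
  128ⁿ≼₀729ⁿ = ≼-intro (*-monoʳ-≤ 1 (^-monoˡ-≤ n (≤ᵇ⇒≤ 128 729 _)))
  P≡ : 128 ^ n * 4 ^ n ≡ 2 ^ (9 * n)
  P≡ = trans (sym (^-distribʳ-* 128 4 n)) (^-*-assoc 2 9 n)
  Q≡ : 729 ^ n * (27 ^ n * K) ≡ 27 ^ (3 * n) * K
  Q≡ = begin-equality
    729 ^ n * (27 ^ n * K)  ≡⟨ *-assoc (729 ^ n) (27 ^ n) K ⟨
    729 ^ n * 27 ^ n * K    ≡⟨ cong (_* K) (^-distribʳ-* 729 27 n) ⟨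
    19683 ^ n * K           ≡⟨ cong (_* K) (^-*-assoc 27 3 n) ⟩
    27 ^ (3 * n) * K        ∎
  rearrange : ∀ x y z → x * (y * z) ≡ z * x * y
  rearrange = solve-∀

-- 2-merge sort on annotated runs

lens : List Run → List ℕ
lens = map len

total : (Run → ℕ) → List Run → ℕ
total φ S = sum (map φ S)

Additive : (Run → ℕ) → Set
Additive φ = ∀ A B → φ (A ⊕ B) ≡ φ A + φ B

collapseRuns : ℕ → List Run → List Run
collapseRuns zero S = S
collapseRuns (suc f) (Z ∷ Y ∷ []) =
  if len Y <ᵇ 2 * len Z then collapseRuns f (Y ⊕ Z ∷ []) else Z ∷ Y ∷ []
collapseRuns (suc f) (Z ∷ Y ∷ X ∷ S) =
  if len Y <ᵇ 2 * len Z
  then (if len X <ᵇ len Z then collapseRuns f (Z ∷ X ⊕ Y ∷ S) else collapseRuns f (Y ⊕ Z ∷ X ∷ S))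
  else Z ∷ Y ∷ X ∷ S
collapseRuns (suc f) S = S

pushRuns : List ℕ → List Run → List Run
pushRuns [] S = S
pushRuns (r ∷ rs) S = pushRuns rs (collapseRuns (length (r ∷ lens S)) (fresh r ∷ S))

mergeDown : Run → List Run → Run
mergeDown Z [] = Z
mergeDown Z (Y ∷ S) = mergeDown (Y ⊕ Z) S

finalRun : List Run → Run
finalRun [] = run 0 0 0
finalRun (Z ∷ S) = mergeDown Z S

lens-collapseRuns : ∀ f S → lens (collapseRuns f S) ≡ proj₂ (collapse f (lens S))
lens-collapseRuns zero S = refl
lens-collapseRuns (suc f) [] = refl
lens-collapseRuns (suc f) (Z ∷ []) = refl
lens-collapseRuns (suc f) (Z ∷ Y ∷ []) with len Y <ᵇ 2 * len Z
... | true  = lens-collapseRuns f (Y ⊕ Z ∷ [])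
... | false = refl
lens-collapseRuns (suc f) (Z ∷ Y ∷ X ∷ S) with len Y <ᵇ 2 * len Z | len X <ᵇ len Z
... | true  | true  = lens-collapseRuns f (Z ∷ X ⊕ Y ∷ S)
... | true  | false = lens-collapseRuns f (Y ⊕ Z ∷ X ∷ S)
... | false | _     = refl

cost-⊕-top : ∀ Y Z S c → total cost (Y ⊕ Z ∷ S) + c ≡ total cost (Z ∷ Y ∷ S) + (len Y + len Z + c)
cost-⊕-top Y Z S = rearrange (cost Y) (cost Z) (total cost S) (len Y + len Z)
  where
  rearrange : ∀ y z T m c → y + z + m + T + c ≡ z + (y + T) + (m + c)
  rearrange = solve-∀

cost-⊕-below : ∀ Z Y X S c → total cost (Z ∷ X ⊕ Y ∷ S) + c ≡ total cost (Z ∷ Y ∷ X ∷ S) + (len X + len Y + c)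
cost-⊕-below Z Y X S = rearrange (cost Z) (cost Y) (cost X) (total cost S) (len X + len Y)
  where
  rearrange : ∀ z y x T m c → z + (x + y + m + T) + c ≡ z + (y + (x + T)) + (m + c)
  rearrange = solve-∀

cost-collapseRuns : ∀ f S → total cost (collapseRuns f S) ≡ total cost S + proj₁ (collapse f (lens S))
cost-collapseRuns zero S = sym (+-identityʳ _)
cost-collapseRuns (suc f) [] = refl
cost-collapseRuns (suc f) (Z ∷ []) = sym (+-identityʳ _)
cost-collapseRuns (suc f) (Z ∷ Y ∷ []) with len Y <ᵇ 2 * len Z
... | true  = trans (cost-collapseRuns f (Y ⊕ Z ∷ [])) (cost-⊕-top Y Z [] _)
... | false = sym (+-identityʳ _)
cost-collapseRuns (suc f) (Z ∷ Y ∷ X ∷ S) with len Y <ᵇ 2 * len Z | len X <ᵇ len Z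
... | true  | true  = trans (cost-collapseRuns f (Z ∷ X ⊕ Y ∷ S)) (cost-⊕-below Z Y X S _)
... | true  | false = trans (cost-collapseRuns f (Y ⊕ Z ∷ X ∷ S)) (cost-⊕-top Y Z (X ∷ S) _)
... | false | _     = sym (+-identityʳ _)

total-⊕-top : ∀ φ → Additive φ → ∀ Y Z S → total φ (Y ⊕ Z ∷ S) ≡ total φ (Z ∷ Y ∷ S)
total-⊕-top φ φ-⊕ Y Z S = trans (cong (_+ total φ S) (φ-⊕ Y Z)) (x+y+z≡y+[x+z] (φ Y) (φ Z) (total φ S))

total-⊕-below : ∀ φ → Additive φ → ∀ Z Y X S → total φ (Z ∷ X ⊕ Y ∷ S) ≡ total φ (Z ∷ Y ∷ X ∷ S)
total-⊕-below φ φ-⊕ Z Y X S = cong (φ Z +_) (total-⊕-top φ φ-⊕ X Y S)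

total-collapseRuns : ∀ φ → Additive φ → ∀ f S → total φ (collapseRuns f S) ≡ total φ S
total-collapseRuns φ φ-⊕ zero S = refl
total-collapseRuns φ φ-⊕ (suc f) [] = refl
total-collapseRuns φ φ-⊕ (suc f) (Z ∷ []) = refl
total-collapseRuns φ φ-⊕ (suc f) (Z ∷ Y ∷ []) with len Y <ᵇ 2 * len Z
... | true  = trans (total-collapseRuns φ φ-⊕ f (Y ⊕ Z ∷ [])) (total-⊕-top φ φ-⊕ Y Z [])
... | false = refl
total-collapseRuns φ φ-⊕ (suc f) (Z ∷ Y ∷ X ∷ S) with len Y <ᵇ 2 * len Z | len X <ᵇ len Z
... | true  | true  = trans (total-collapseRuns φ φ-⊕ f (Z ∷ X ⊕ Y ∷ S)) (total-⊕-below φ φ-⊕ Z Y X S)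
... | true  | false = trans (total-collapseRuns φ φ-⊕ f (Y ⊕ Z ∷ X ∷ S)) (total-⊕-top φ φ-⊕ Y Z (X ∷ S))
... | false | _     = refl

lens-pushRuns : ∀ rs S → lens (pushRuns rs S) ≡ proj₂ (pushPhase rs (lens S))
lens-pushRuns []       S = refl
lens-pushRuns (r ∷ rs) S =
  trans (lens-pushRuns rs _)
        (cong (λ s → proj₂ (pushPhase rs s)) (lens-collapseRuns (length (r ∷ lens S)) (fresh r ∷ S)))

cost-pushRuns : ∀ rs S → total cost (pushRuns rs S) ≡ total cost S + proj₁ (pushPhase rs (lens S))
cost-pushRuns []       S = sym (+-identityʳ _)
cost-pushRuns (r ∷ rs) S = begin
  total cost (pushRuns rs S′)                              ≡⟨ cost-pushRuns rs S′ ⟩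
  total cost S′ + proj₁ (pushPhase rs (lens S′))
    ≡⟨ cong₂ _+_ (cost-collapseRuns f (fresh r ∷ S))
                 (cong (λ s → proj₁ (pushPhase rs s)) (lens-collapseRuns f (fresh r ∷ S))) ⟩
  total cost S + proj₁ C + proj₁ (pushPhase rs (proj₂ C))  ≡⟨ +-assoc (total cost S) _ _ ⟩
  total cost S + proj₁ (pushPhase (r ∷ rs) (lens S))       ∎
  where
  open ≡-Reasoning
  f = length (r ∷ lens S)
  S′ = collapseRuns f (fresh r ∷ S)
  C = collapse f (r ∷ lens S)

total-pushRuns : ∀ φ → Additive φ → ∀ rs S → total φ (pushRuns rs S) ≡ total φ (map fresh rs) + total φ S
total-pushRuns φ φ-⊕ []       S = refl
total-pushRuns φ φ-⊕ (r ∷ rs) S = begin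
  total φ (pushRuns rs S′)                  ≡⟨ total-pushRuns φ φ-⊕ rs S′ ⟩
  F + total φ S′                            ≡⟨ cong (F +_) (total-collapseRuns φ φ-⊕ f (fresh r ∷ S)) ⟩
  F + (φ (fresh r) + total φ S)             ≡⟨ x+[y+z]≡y+[x+z] F (φ (fresh r)) (total φ S) ⟩
  φ (fresh r) + (F + total φ S)             ≡⟨ +-assoc (φ (fresh r)) F (total φ S) ⟨
  total φ (map fresh (r ∷ rs)) + total φ S  ∎
  where
  open ≡-Reasoning
  F = total φ (map fresh rs)
  f = length (r ∷ lens S)
  S′ = collapseRuns f (fresh r ∷ S)

cost-mergeDown : ∀ Z S → cost (mergeDown Z S) ≡ cost Z + total cost S + finalFrom (len Z) (lens S)
cost-mergeDown Z [] = sym (trans (+-identityʳ _) (+-identityʳ _))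
cost-mergeDown Z (Y ∷ S) =
  trans (cost-mergeDown (Y ⊕ Z) S)
        (rearrange (cost Y) (cost Z) (len Y + len Z) (total cost S) (finalFrom (len Y + len Z) (lens S)))
  where
  rearrange : ∀ y z m T F → y + z + m + T + F ≡ z + (y + T) + (m + F)
  rearrange = solve-∀

total-mergeDown : ∀ φ → Additive φ → ∀ Z S → φ (mergeDown Z S) ≡ φ Z + total φ S
total-mergeDown φ φ-⊕ Z [] = sym (+-identityʳ _)
total-mergeDown φ φ-⊕ Z (Y ∷ S) = begin
  φ (mergeDown (Y ⊕ Z) S)   ≡⟨ total-mergeDown φ φ-⊕ (Y ⊕ Z) S ⟩
  φ (Y ⊕ Z) + total φ S     ≡⟨ total-⊕-top φ φ-⊕ Y Z S ⟩
  φ Z + (φ Y + total φ S)   ∎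
  where open ≡-Reasoning

cost-finalRun : ∀ S → cost (finalRun S) ≡ total cost S + finalCost (lens S)
cost-finalRun [] = refl
cost-finalRun (Z ∷ S) = cost-mergeDown Z S

total-finalRun : ∀ φ → Additive φ → φ (run 0 0 0) ≡ 0 → ∀ S → φ (finalRun S) ≡ total φ S
total-finalRun φ φ-⊕ φ-ε [] = φ-ε
total-finalRun φ φ-⊕ φ-ε (Z ∷ S) = total-mergeDown φ φ-⊕ Z S

sortRun : List ℕ → Run
sortRun runs = finalRun (pushRuns runs [])

cost-sortRun : ∀ runs → cost (sortRun runs) ≡ mergeCost2 runs
cost-sortRun runs = trans (cost-finalRun (pushRuns runs []))
  (cong₂ _+_ (cost-pushRuns runs []) (cong finalCost (lens-pushRuns runs [])))

len-sortRun : ∀ runs → len (sortRun runs) ≡ sum runs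
len-sortRun runs = begin
  len (sortRun runs)                ≡⟨ total-finalRun len (λ _ _ → refl) refl (pushRuns runs []) ⟩
  total len (pushRuns runs [])      ≡⟨ total-pushRuns len (λ _ _ → refl) runs [] ⟩
  total len (map fresh runs) + 0    ≡⟨ +-identityʳ _ ⟩
  total len (map fresh runs)        ≡⟨ cong sum (trans (sym (map-∘ runs)) (map-id runs)) ⟩
  sum runs                          ∎
  where open ≡-Reasoning

count-sortRun : ∀ runs → count (sortRun runs) ≡ length runs
count-sortRun runs = begin
  count (sortRun runs)              ≡⟨ total-finalRun count (λ _ _ → refl) refl (pushRuns runs []) ⟩
  total count (pushRuns runs [])    ≡⟨ total-pushRuns count (λ _ _ → refl) runs [] ⟩
  total count (map fresh runs) + 0  ≡⟨ +-identityʳ _ ⟩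
  total count (map fresh runs)      ≡⟨ total-count-fresh runs ⟩
  length runs                       ∎
  where
  open ≡-Reasoning
  total-count-fresh : ∀ rs → total count (map fresh rs) ≡ length rs
  total-count-fresh []       = refl
  total-count-fresh (r ∷ rs) = cong suc (total-count-fresh rs)

-- The stack invariant

infixr 5 _∷⟨_⟩_

data Valid : List Run → Set where
  []     : Valid []
  [_]    : ∀ {Z} → Economical Z → Valid (Z ∷ [])
  _∷⟨_⟩_ : ∀ {Z Y S} → Economical Z → 2 * len Z ≤ len Y → Valid (Y ∷ S) → Valid (Z ∷ Y ∷ S)

chain-economical : ∀ {W M x} → Economical W → 1 ≤ count M → Economical (M ⊕ fresh x) →
                   len M ≤ 2 * x → 2 * x ≤ len W → Economical ((W ⊕ M) ⊕ fresh (len W))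
chain-economical {W} {M} eW 1≤k eMx m≤2x 2x≤w =
  subst Economical (⊕-fresh-assoc W M)
    (⊕-economical eW (⊕-fresh-mono M 1≤k (2m≤n⇒m≤n 2x≤w) eMx)
       (≤-trans (m≤n+m (len W) (len M)) (m≤n*m _ 2))
       (m+n≤2*o (≤-trans m≤2x 2x≤w) ≤-refl))

collapse-valid : ∀ f Z S → length S ≤ f → Economical Z → Valid S →
                 Maybe.All (λ Y → len Z ≤ 2 * len Y) (head S) → Valid (collapseRuns f (Z ∷ S))
collapse-valid zero    Z [] _ eZ _ _ = [ eZ ]
collapse-valid (suc f) Z [] _ eZ _ _ = [ eZ ]
collapse-valid (suc f) Z (Y ∷ []) _ eZ [ eY ] (just z≤2y)
  with len Y <ᵇ 2 * len Z | <ᵇ-reflects-< (len Y) (2 * len Z)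
... | true  | ofʸ y<2z = collapse-valid f (Y ⊕ Z) [] z≤n (⊕-economical eY eZ (<⇒≤ y<2z) z≤2y) [] nothing
... | false | ofⁿ y≮2z = eZ ∷⟨ ≮⇒≥ y≮2z ⟩ [ eY ]
collapse-valid (suc f) Z (Y ∷ X ∷ S) (s≤s fuel) eZ (eY ∷⟨ 2y≤x ⟩ vX) (just z≤2y)
  with len Y <ᵇ 2 * len Z | <ᵇ-reflects-< (len Y) (2 * len Z) | len X <ᵇ len Z | <ᵇ-reflects-< (len X) (len Z)
... | true  | ofʸ _    | true  | ofʸ x<z = contradiction (≤-trans z≤2y 2y≤x) (<⇒≱ x<z)
... | true  | ofʸ y<2z | false | ofⁿ _   =
  collapse-valid f (Y ⊕ Z) (X ∷ S) fuel (⊕-economical eY eZ (<⇒≤ y<2z) z≤2y) vX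
    (just (m+n≤2*o (2m≤n⇒m≤n 2y≤x) (≤-trans z≤2y 2y≤x)))
... | false | ofⁿ y≮2z | _     | _       = eZ ∷⟨ ≮⇒≥ y≮2z ⟩ eY ∷⟨ 2y≤x ⟩ vX

valid-head : ∀ {Z S} → Valid (Z ∷ S) → Economical Z
valid-head [ eZ ]       = eZ
valid-head (eZ ∷⟨ _ ⟩ _) = eZ

valid-tail : ∀ {Z S} → Valid (Z ∷ S) → Valid S
valid-tail [ _ ]        = []
valid-tail (_ ∷⟨ _ ⟩ v) = v

valid-gap : ∀ {Z S} → Valid (Z ∷ S) → Maybe.All (λ Y → 2 * len Z ≤ len Y) (head S)
valid-gap [ _ ]          = nothing
valid-gap (_ ∷⟨ gap ⟩ _) = just gap

-- While runs are merged into M beneath the pushed run z, M itself need not be economical; the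
-- invariant is that M merged with a fresh run of length x is, where x is the length of the run
-- that M absorbed last.
chain-valid : ∀ f z M x S → suc (length S) ≤ f → 1 ≤ count M → Economical (M ⊕ fresh x) →
              len M ≤ 2 * x → x < z → Valid S → Maybe.All (λ W → 2 * x ≤ len W) (head S) →
              Valid (collapseRuns f (fresh z ∷ M ∷ S))
chain-valid (suc f) z M x [] _ 1≤k eMx m≤2x x<z [] nothing
  with len M <ᵇ 2 * z | <ᵇ-reflects-< (len M) (2 * z)
... | true  | ofʸ _    = collapse-valid f (M ⊕ fresh z) [] z≤n (⊕-fresh-mono M 1≤k (<⇒≤ x<z) eMx) [] nothing
... | false | ofⁿ m≮2z = contradiction (≤-<-trans m≤2x (*-monoʳ-< 2 x<z)) m≮2z
chain-valid (suc f) z M x (W ∷ S) (s≤s fuel) 1≤k eMx m≤2x x<z vW (just 2x≤w)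
  with len M <ᵇ 2 * z | <ᵇ-reflects-< (len M) (2 * z) | len W <ᵇ z | <ᵇ-reflects-< (len W) z
... | true  | ofʸ _    | true  | ofʸ w<z =
  chain-valid f z (W ⊕ M) (len W) S fuel (≤-trans (nonempty (valid-head vW)) (m≤m+n _ _))
    (chain-economical (valid-head vW) 1≤k eMx m≤2x 2x≤w) (m+n≤2*o ≤-refl (≤-trans m≤2x 2x≤w)) w<z
    (valid-tail vW) (valid-gap vW)
... | true  | ofʸ _    | false | ofⁿ w≮z =
  collapse-valid f (M ⊕ fresh z) (W ∷ S) fuel (⊕-fresh-mono M 1≤k (<⇒≤ x<z) eMx) vW
    (just (m+n≤2*o (≤-trans m≤2x 2x≤w) (≮⇒≥ w≮z)))
... | false | ofⁿ m≮2z | _     | _       = contradiction (≤-<-trans m≤2x (*-monoʳ-< 2 x<z)) m≮2z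

push-valid : ∀ f z S → length S ≤ f → Valid S → Valid (collapseRuns f (fresh z ∷ S))
push-valid zero    z [] _ [] = [ fresh-economical z ]
push-valid (suc f) z [] _ [] = [ fresh-economical z ]
push-valid (suc f) z (Y ∷ []) _ [ eY ] with len Y <ᵇ 2 * z | <ᵇ-reflects-< (len Y) (2 * z)
... | true  | ofʸ y<2z = collapse-valid f (Y ⊕ fresh z) [] z≤n (⊕-fresh-economical eY (<⇒≤ y<2z)) [] nothing
... | false | ofⁿ y≮2z = fresh-economical z ∷⟨ ≮⇒≥ y≮2z ⟩ [ eY ]
push-valid (suc f) z (Y ∷ X ∷ S) (s≤s fuel) (eY ∷⟨ 2y≤x ⟩ vX)
  with len Y <ᵇ 2 * z | <ᵇ-reflects-< (len Y) (2 * z) | len X <ᵇ z | <ᵇ-reflects-< (len X) z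
... | true  | ofʸ _    | true  | ofʸ x<z =
  chain-valid f z (X ⊕ Y) (len X) S fuel (≤-trans (nonempty eY) (m≤n+m _ _))
    (chain-economical {x = len Y} (valid-head vX) (nonempty eY) (⊕-fresh-economical eY (m≤n*m _ 2))
                      (m≤n*m _ 2) 2y≤x)
    (m+n≤2*o ≤-refl (2m≤n⇒m≤n 2y≤x)) x<z (valid-tail vX) (valid-gap vX)
... | true  | ofʸ y<2z | false | ofⁿ x≮z =
  collapse-valid f (Y ⊕ fresh z) (X ∷ S) fuel (⊕-fresh-economical eY (<⇒≤ y<2z)) vX
    (just (m+n≤2*o (2m≤n⇒m≤n 2y≤x) (≮⇒≥ x≮z)))
... | false | ofⁿ y≮2z | _     | _       = fresh-economical z ∷⟨ ≮⇒≥ y≮2z ⟩ eY ∷⟨ 2y≤x ⟩ vX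

pushRuns-valid : ∀ rs S → Valid S → Valid (pushRuns rs S)
pushRuns-valid []       S v = v
pushRuns-valid (r ∷ rs) S v =
  pushRuns-valid rs _ (push-valid _ r S (≤-trans (≤-reflexive (sym (length-map len S))) (n≤1+n _)) v)

mergeDown-economical⁺ : ∀ Z S → Economical⁺ Z → Valid S → Maybe.All (λ Y → len Z ≤ len Y) (head S) →
                        Economical⁺ (mergeDown Z S)
mergeDown-economical⁺ Z []      eZ _  _          = eZ
mergeDown-economical⁺ Z (Y ∷ S) eZ vY (just z≤y) =
  mergeDown-economical⁺ (Y ⊕ Z) S (⊕-economical⁺ (valid-head vY) eZ z≤y) (valid-tail vY)
    (Maybe.map (≤-trans (m+n≤2*o ≤-refl z≤y)) (valid-gap vY))

finalRun-economical⁺ : ∀ {S} → Valid S → Economical⁺ (finalRun S)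
finalRun-economical⁺ [] = ≼-refl
finalRun-economical⁺ {Z ∷ S} v =
  mergeDown-economical⁺ Z S (economical⇒economical⁺ (valid-head v)) (valid-tail v)
                        (Maybe.map 2m≤n⇒m≤n (valid-gap v))

sortRun-economical⁺ : ∀ runs → Economical⁺ (sortRun runs)
sortRun-economical⁺ runs = finalRun-economical⁺ (pushRuns-valid runs [] [])

theorem13 : (runs : List ℕ) → All (λ k → 1 ≤ k) runs →
    2 ^ (9 * sum runs) * 27 ^ mergeCost2 runs
      ≤ length runs ^ (3 * sum runs) * 4 ^ mergeCost2 runs * 27 ^ (3 * sum runs)
theorem13 runs _
  rewrite sym (cost-sortRun runs) | sym (len-sortRun runs) | sym (count-sortRun runs) =
  economical⁺-bound (sortRun runs) (sortRun-economical⁺ runs)
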